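{- The set $\mathcal{P}$ of decimal palindromes is an additive basis for the natural numbers $\mathbb{N}=\{0,1,2,\ldots\}$. More precisely, every natural number is the sum of forty-nine (possibly zero) decimal palindromes.
   Context: Every $n\in\mathbb{N}$ has a unique decimal representation $n=\sum_{j=0}^{L-1}10^j\delta_j$ with digits $\delta_j\in\{0,1,\ldots,9\}$ and leading digit $\delta_{L-1}\neq 0$ whenever $L\ge 2$ (so $0$ has the single digit $0$, $L=1$). The number $n$ is a (decimal) palindrome if $\delta_j=\delta_{L-1-j}$ for all $0\le j<L$. $\mathcal{P}$ denotes the set of all palindromes in $\mathbb{N}$; in particular $0$ and every single digit are palindromes. -}

module Defs where

open import Data.Nat using (ℕ; zero; suc; _+_; _*_; _<_; _≤_)
open import Data.List using (List; []; _∷_; reverse; length; last; map; sum)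
open import Data.Maybe using (Maybe; just)
open import Data.Product using (Σ; _×_; ∃)
open import Data.Sum using (_⊎_)
open import Data.Vec using (Vec; foldr)
open import Relation.Binary.PropositionalEquality using (_≡_; _≢_)
open import Data.List.Relation.Unary.All using (All)

value : List ℕ → ℕ
value []       = 0
value (d ∷ ds) = d + 10 * value ds

-- ds is a decimal representation (least significant digit first) of n:
-- nonempty, all digits < 10, leading digit nonzero when length ≥ 2, and value ds ≡ n.
-- (By uniqueness of decimal representations this is THE representation of n.)
record IsDecimalRep (ds : List ℕ) (n : ℕ) : Set where
  field
    digits<10 : All (_< 10) ds
    nonempty  : 1 ≤ length ds
    leading   : length ds ≡ 1 ⊎ (∃ λ d → last ds ≡ just d × d ≢ 0)
    val       : value ds ≡ n

IsPalindrome : ℕ → Set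
IsPalindrome n = Σ (List ℕ) λ ds → IsDecimalRep ds n × reverse ds ≡ ds

vsum : ∀ {k} → Vec ℕ k → ℕ
vsum = foldr _ _+_ 0

{-# OPTIONS --safe #-}
module Submission where

-- Write n = s · (10 ^ (ℓ + 1) + 1) + 10 m.  Enclosing digit strings is additive, so if s is a sum of k
-- digits d_i and m a sum of k palindromic ℓ-digit strings w_i (leading zeros allowed), then n is the sum
-- of the k palindromic strings d_i w_i d_i.  Choosing the last digit of s to be that of n and m in
-- [10 ^ ℓ, 11 · 10 ^ ℓ], this recursion shows that every m in that range (a multiple of 11 if ℓ is even,
-- as every even-length palindrome is) is a sum of 15 such strings.  For a large multiple n of 11 the same
-- splitting with 20 ≤ s < 420, s = a + b, 15 ≤ a ≤ 135, b ≤ 288, yields 15 genuine palindromes with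
-- nonzero outer digits and 32 palindromes b_i 0…0 b_i; two more digits account for n mod 11.  Below 3030,
-- n = 101 q + 11 b + c directly.

open import Defs
open import Data.Nat using (ℕ; zero; suc; _+_; _*_; _∸_; _^_; _≤_; _<_; z≤n; s≤s; s≤s⁻¹; NonZero; _<?_; _⊓_)
open import Data.Nat.Properties
open import Data.Nat.DivMod using (_/_; _%_; m≡m%n+[m/n]*n; m%n<n; m/n*n≤m; m*n/n≡m; /-monoˡ-≤; m<n*o⇒m/o<n)
open import Data.Nat.Divisibility using (_∣_; divides; ∣-refl; ∣m∣n⇒∣m+n; ∣m+n∣m⇒∣n; ∣n⇒∣m*n; ∣m⇒∣m*n; m∣m*n; n∣m*n)
open import Data.Nat.Tactic.RingSolver using (solve-∀)
open import Data.Product using (Σ; _×_; _,_; ∃-syntax; ∃₂)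
open import Data.Sum using (inj₁; inj₂)
open import Data.Maybe using (just)
open import Data.Unit using (⊤; tt)
open import Data.List as List using (List; []; _∷_; _∷ʳ_; reverse; length; last)
import Data.List.Properties as List
import Data.List.Relation.Unary.All as ListAll
import Data.List.Relation.Unary.All.Properties as ListAll
open import Data.Vec as Vec using (Vec; []; _∷_)
import Data.Vec.Properties as Vec
open import Data.Vec.Relation.Unary.All as All using (All; []; _∷_)
import Data.Vec.Relation.Unary.All.Properties as All
open import Relation.Binary.PropositionalEquality
open import Relation.Nullary using (Dec; yes; no)

-- The value of the string d w d (least significant digit first), w an ℓ-digit string of value x.
enclose : ℕ → ℕ → ℕ → ℕ
enclose ℓ d x = d + 10 * (x + 10 ^ ℓ * d)

-- Pal ℓ x : x is the value of a palindromic string of exactly ℓ digits, leading zeros allowed.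
data Pal : ℕ → ℕ → Set where
  empty  : Pal 0 0
  single : ∀ {d} → d < 10 → Pal 1 d
  wrap   : ∀ {ℓ d x} → d < 10 → Pal ℓ x → Pal (2 + ℓ) (enclose ℓ d x)

digits : ∀ {ℓ x} → Pal ℓ x → List ℕ
digits empty              = []
digits (single {d} _)     = d ∷ []
digits (wrap {d = d} _ p) = d ∷ digits p ∷ʳ d

length-digits : ∀ {ℓ x} (p : Pal ℓ x) → length (digits p) ≡ ℓ
length-digits empty              = refl
length-digits (single _)         = refl
length-digits (wrap {d = d} _ p) = cong suc (trans (List.length-++ (digits p)) (trans (cong (_+ 1) (length-digits p)) (+-comm _ 1)))

value-∷ʳ : ∀ ds d → value (ds ∷ʳ d) ≡ value ds + 10 ^ length ds * d
value-∷ʳ []       d = trans (+-identityʳ d) (sym (*-identityˡ d))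
value-∷ʳ (e ∷ ds) d = begin
  e + 10 * value (ds ∷ʳ d)                    ≡⟨ cong (λ v → e + 10 * v) (value-∷ʳ ds d) ⟩
  e + 10 * (value ds + 10 ^ length ds * d)    ≡⟨ distribute e (value ds) (10 ^ length ds) d ⟩
  e + 10 * value ds + 10 * 10 ^ length ds * d ∎
  where
  open ≡-Reasoning
  distribute : ∀ e v p d → e + 10 * (v + p * d) ≡ e + 10 * v + 10 * p * d
  distribute = solve-∀

value-digits : ∀ {ℓ x} (p : Pal ℓ x) → value (digits p) ≡ x
value-digits empty                  = refl
value-digits (single {d} _)         = +-identityʳ d
value-digits (wrap {ℓ} {d} {x} _ p) = cong (λ v → d + 10 * v) (begin
  value (digits p ∷ʳ d)                       ≡⟨ value-∷ʳ (digits p) d ⟩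
  value (digits p) + 10 ^ length (digits p) * d ≡⟨ cong₂ (λ v k → v + 10 ^ k * d) (value-digits p) (length-digits p) ⟩
  x + 10 ^ ℓ * d                              ∎)
  where open ≡-Reasoning

digits<10 : ∀ {ℓ x} (p : Pal ℓ x) → ListAll.All (_< 10) (digits p)
digits<10 empty         = ListAll.[]
digits<10 (single d<10) = d<10 ListAll.∷ ListAll.[]
digits<10 (wrap d<10 p) = d<10 ListAll.∷ ListAll.++⁺ (digits<10 p) (d<10 ListAll.∷ ListAll.[])

reverse-digits : ∀ {ℓ x} (p : Pal ℓ x) → reverse (digits p) ≡ digits p
reverse-digits empty              = refl
reverse-digits (single _)         = refl
reverse-digits (wrap {d = d} _ p) = begin
  reverse (d ∷ digits p ∷ʳ d)      ≡⟨ List.unfold-reverse d (digits p ∷ʳ d) ⟩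
  reverse (digits p ∷ʳ d) ∷ʳ d     ≡⟨ cong (_∷ʳ d) (List.reverse-++ (digits p) (d ∷ [])) ⟩
  d ∷ reverse (digits p) ∷ʳ d      ≡⟨ cong (λ ds → d ∷ ds ∷ʳ d) (reverse-digits p) ⟩
  d ∷ digits p ∷ʳ d                ∎
  where open ≡-Reasoning

enclose-zero : ∀ ℓ → enclose ℓ 0 0 ≡ 0
enclose-zero ℓ = cong (10 *_) (*-zeroʳ (10 ^ ℓ))

pal-zero : ∀ ℓ → Pal ℓ 0
pal-zero 0             = empty
pal-zero 1             = single (s≤s z≤n)
pal-zero (suc (suc ℓ)) = subst (Pal (2 + ℓ)) (enclose-zero ℓ) (wrap (s≤s z≤n) (pal-zero ℓ))

digit-isPalindrome : ∀ {d} → d < 10 → IsPalindrome d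
digit-isPalindrome {d} d<10 = d ∷ [] , rep , refl
  where
  rep : IsDecimalRep (d ∷ []) d
  rep = record { digits<10 = d<10 ListAll.∷ ListAll.[] ; nonempty = s≤s z≤n ; leading = inj₁ refl ; val = +-identityʳ d }

last-∷ʳ : ∀ (ds : List ℕ) d → last (ds ∷ʳ d) ≡ just d
last-∷ʳ []           d = refl
last-∷ʳ (_ ∷ [])     d = refl
last-∷ʳ (_ ∷ e ∷ ds) d = last-∷ʳ (e ∷ ds) d

enclose-isPalindrome : ∀ {ℓ d x} → 0 < d → d < 10 → Pal ℓ x → IsPalindrome (enclose ℓ d x)
enclose-isPalindrome {ℓ} {d} {x} 0<d d<10 p = digits q , rep , reverse-digits q
  where
  q : Pal (2 + ℓ) (enclose ℓ d x)
  q = wrap d<10 p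
  rep : IsDecimalRep (digits q) (enclose ℓ d x)
  rep = record
    { digits<10 = digits<10 q
    ; nonempty  = s≤s z≤n
    ; leading   = inj₂ (d , last-∷ʳ (d ∷ digits p) d , >⇒≢ 0<d)
    ; val       = value-digits q
    }

enclose-zero-isPalindrome : ∀ ℓ {d} → d < 10 → IsPalindrome (enclose ℓ d 0)
enclose-zero-isPalindrome ℓ {zero}  _    = subst IsPalindrome (sym (enclose-zero ℓ)) (digit-isPalindrome (s≤s z≤n))
enclose-zero-isPalindrome ℓ {suc d} d<10 = enclose-isPalindrome (s≤s z≤n) d<10 (pal-zero ℓ)

SumOf : ℕ → (ℕ → Set) → ℕ → Set
SumOf k P n = Σ (Vec ℕ k) λ v → All P v × vsum v ≡ n

sumOf-++ : ∀ {k l P a b} → SumOf k P a → SumOf l P b → SumOf (k + l) P (a + b)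
sumOf-++ (u , Pu , refl) (v , Pv , refl) = u Vec.++ v , All.++⁺ Pu Pv , Vec.sum-++ u

sumOf-map : ∀ {k P Q n} → (∀ {x} → P x → Q x) → SumOf k P n → SumOf k Q n
sumOf-map f (v , Pv , eq) = v , All.map f Pv , eq

sumOf-zero : ∀ {P} k → P 0 → SumOf k P 0
sumOf-zero zero    P0 = [] , [] , refl
sumOf-zero (suc k) P0 with sumOf-zero k P0
... | v , Pv , eq = 0 ∷ v , P0 ∷ Pv , eq

sumOf-≤ : ∀ b k {s} → s ≤ b * k → SumOf k (_≤ b) s
sumOf-≤ b zero    {s} s≤ = [] , [] , sym (n≤0⇒n≡0 (subst (s ≤_) (*-zeroʳ b) s≤))
sumOf-≤ b (suc k) {s} s≤ with sumOf-≤ b k (m≤n+o⇒m∸n≤o s b (subst (s ≤_) (*-suc b k) s≤))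
... | v , v≤b , eq = b ⊓ s ∷ v , m⊓n≤m b s ∷ v≤b , trans (cong (b ⊓ s +_) eq) (m⊓n+n∸m≡n b s)

sumOf-digits : ∀ k {s} → s ≤ 9 * k → SumOf k (_< 10) s
sumOf-digits k s≤ = sumOf-map s≤s (sumOf-≤ 9 k s≤)

NonzeroDigit : ℕ → Set
NonzeroDigit d = 0 < d × d < 10

vsum-map-suc : ∀ {k} (v : Vec ℕ k) → vsum (Vec.map suc v) ≡ k + vsum v
vsum-map-suc []              = refl
vsum-map-suc {suc k} (x ∷ v) = cong suc (trans (cong (x +_) (vsum-map-suc v)) (swap x k (vsum v)))
  where
  swap : ∀ x k s → x + (k + s) ≡ k + (x + s)
  swap = solve-∀

sumOf-nonzeroDigits : ∀ k {s} → k ≤ s → s ≤ 9 * k → SumOf k NonzeroDigit s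
sumOf-nonzeroDigits k {s} k≤s s≤ = increment (sumOf-≤ 8 k (m≤n+o⇒m∸n≤o s k (subst (s ≤_) (nine k) s≤)))
  where
  nine : ∀ k → 9 * k ≡ k + 8 * k
  nine = solve-∀
  increment : SumOf k (_≤ 8) (s ∸ k) → SumOf k NonzeroDigit s
  increment (v , v≤8 , eq) =
    Vec.map suc v ,
    All.map⁺ (All.map (λ d≤8 → s≤s z≤n , s≤s (s≤s d≤8)) v≤8) ,
    trans (vsum-map-suc v) (trans (cong (k +_) eq) (m+[n∸m]≡n k≤s))

enclose-+ : ∀ ℓ a b x y → enclose ℓ (a + b) (x + y) ≡ enclose ℓ a x + enclose ℓ b y
enclose-+ ℓ a b x y = linear a b x y (10 ^ ℓ)
  where
  linear : ∀ a b x y p → a + b + 10 * (x + y + p * (a + b)) ≡ a + 10 * (x + p * a) + (b + 10 * (y + p * b))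
  linear = solve-∀

vsum-zipWith-enclose : ∀ ℓ {k} (u v : Vec ℕ k) → vsum (Vec.zipWith (enclose ℓ) u v) ≡ enclose ℓ (vsum u) (vsum v)
vsum-zipWith-enclose ℓ []      []      = sym (enclose-zero ℓ)
vsum-zipWith-enclose ℓ (a ∷ u) (x ∷ v) =
  trans (cong (enclose ℓ a x +_) (vsum-zipWith-enclose ℓ u v)) (sym (enclose-+ ℓ a (vsum u) x (vsum v)))

sumOf-enclose : ∀ ℓ {k s m} {P Q R : ℕ → Set} → (∀ {d x} → P d → Q x → R (enclose ℓ d x)) →
                SumOf k P s → SumOf k Q m → SumOf k R (enclose ℓ s m)
sumOf-enclose ℓ f (u , Pu , refl) (v , Qv , refl) =
  Vec.zipWith (enclose ℓ) u v , All.zipWith f Pu Qv , vsum-zipWith-enclose ℓ u v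

-- An even-length palindromic string is divisible by 11; Admissible ℓ n is that condition for length ℓ.
Admissible : ℕ → ℕ → Set
Admissible zero          n = 11 ∣ n
Admissible (suc zero)    n = ⊤
Admissible (suc (suc ℓ)) n = Admissible ℓ n

admissible : ∀ ℓ {n} → 11 ∣ n → Admissible ℓ n
admissible zero          11∣n = 11∣n
admissible (suc zero)    _    = tt
admissible (suc (suc ℓ)) 11∣n = admissible ℓ 11∣n

admissible-map : ∀ ℓ {a b} → (11 ∣ a → 11 ∣ b) → Admissible ℓ a → Admissible ℓ b
admissible-map zero          f h = f h
admissible-map (suc zero)    _ _ = tt
admissible-map (suc (suc ℓ)) f h = admissible-map ℓ f h

admissible-map₂ : ∀ ℓ {a b c} → (11 ∣ a → 11 ∣ b → 11 ∣ c) → Admissible ℓ a → Admissible ℓ b → Admissible ℓ c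
admissible-map₂ zero          f g h = f g h
admissible-map₂ (suc zero)    _ _ _ = tt
admissible-map₂ (suc (suc ℓ)) f g h = admissible-map₂ ℓ f g h

outerUnit : ℕ → ℕ
outerUnit ℓ = 1 + 10 ^ suc ℓ

enclose-outerUnit : ∀ ℓ s m → enclose ℓ s m ≡ s * outerUnit ℓ + 10 * m
enclose-outerUnit ℓ s m = expand s m (10 ^ ℓ)
  where
  expand : ∀ s m p → s + 10 * (m + p * s) ≡ s * (1 + 10 * p) + 10 * m
  expand = solve-∀

admissible-outerUnit : ∀ ℓ → Admissible ℓ (outerUnit ℓ)
admissible-outerUnit zero          = ∣-refl
admissible-outerUnit (suc zero)    = tt
admissible-outerUnit (suc (suc ℓ)) = admissible-map ℓ add99 (admissible-outerUnit ℓ)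
  where
  shift : ∀ p → 99 * p + (1 + p) ≡ 1 + 10 * (10 * p)
  shift = solve-∀
  add99 : 11 ∣ outerUnit ℓ → 11 ∣ outerUnit (2 + ℓ)
  add99 h = subst (11 ∣_) (shift (10 ^ suc ℓ)) (∣m∣n⇒∣m+n (∣m⇒∣m*n (10 ^ suc ℓ) (divides 9 refl)) h)

∣enclose⇒∣inner : ∀ {ℓ s m} → 11 ∣ outerUnit ℓ → 11 ∣ enclose ℓ s m → 11 ∣ m
∣enclose⇒∣inner {ℓ} {s} {m} 11∣D 11∣n = ∣m+n∣m⇒∣n (subst (11 ∣_) (eleven m) (m∣m*n m)) 11∣10m
  where
  11∣10m : 11 ∣ 10 * m
  11∣10m = ∣m+n∣m⇒∣n (subst (11 ∣_) (enclose-outerUnit ℓ s m) 11∣n) (∣n⇒∣m*n s 11∣D)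
  eleven : ∀ m → 11 * m ≡ 10 * m + m
  eleven = solve-∀

admissible-enclose⁻ : ∀ ℓ s {m} → Admissible ℓ (enclose ℓ s m) → Admissible ℓ m
admissible-enclose⁻ ℓ s = admissible-map₂ ℓ (∣enclose⇒∣inner {ℓ} {s}) (admissible-outerUnit ℓ)

m*n≤o⇒m≤o/n : ∀ {m o} n .{{_ : NonZero n}} → m * n ≤ o → m ≤ o / n
m*n≤o⇒m≤o/n {m} {o} n h = subst (_≤ o / n) (m*n/n≡m m n) (/-monoˡ-≤ n h)

divide-above : ∀ B t₀ D .{{_ : NonZero D}} N → B + t₀ * D ≤ N →
               ∃₂ λ t ρ → N ≡ B + t * D + ρ × t₀ ≤ t × ρ < D
divide-above B t₀ D N h = t₀ + x / D , x % D , N≡ , m≤m+n t₀ (x / D) , m%n<n x D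
  where
  x : ℕ
  x = N ∸ (B + t₀ * D)
  regroup : ∀ r q D B t₀ → r + q * D + (B + t₀ * D) ≡ B + (t₀ + q) * D + r
  regroup = solve-∀
  N≡ : N ≡ B + (t₀ + x / D) * D + x % D
  N≡ = begin
    N                                   ≡⟨ m∸n+n≡m h ⟨
    x + (B + t₀ * D)                    ≡⟨ cong (_+ (B + t₀ * D)) (m≡m%n+[m/n]*n x D) ⟩
    x % D + x / D * D + (B + t₀ * D)    ≡⟨ regroup (x % D) (x / D) D B t₀ ⟩
    B + (t₀ + x / D) * D + x % D        ∎
    where open ≡-Reasoning

-- The last digit r of n and the quotient t of the division by outerUnit ℓ together give the outer digit
-- sum s = r + 10 t; the rest (at least 10 ^ ℓ, so that t is not too large) is the inner part m.
enclose-decomposition : ∀ ℓ t₀ k n → (10 ^ suc ℓ + t₀ * outerUnit ℓ) * 10 ≤ n → n < k * outerUnit ℓ * 10 →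
  ∃₂ λ s m → n ≡ enclose ℓ s m × 10 * t₀ ≤ s × s < 10 * k × 10 ^ ℓ ≤ m × m ≤ 11 * 10 ^ ℓ
enclose-decomposition ℓ t₀ k n lower upper = split (divide-above ((1 + r) * P) t₀ D (n / 10) B≤N)
  where
  r P D : ℕ
  r = n % 10
  P = 10 ^ ℓ
  D = outerUnit ℓ
  B≤N : (1 + r) * P + t₀ * D ≤ n / 10
  B≤N = ≤-trans (+-monoˡ-≤ (t₀ * D) (*-monoˡ-≤ P (m%n<n n 10))) (m*n≤o⇒m≤o/n 10 lower)
  assemble : ∀ r t ρ P → r + ((1 + r) * P + t * (1 + 10 * P) + ρ) * 10 ≡ r + 10 * t + 10 * (P + ρ + P * (r + 10 * t))
  assemble = solve-∀
  split : (∃₂ λ t ρ → n / 10 ≡ (1 + r) * P + t * D + ρ × t₀ ≤ t × ρ < D) →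
          ∃₂ λ s m → n ≡ enclose ℓ s m × 10 * t₀ ≤ s × s < 10 * k × P ≤ m × m ≤ 11 * P
  split (t , ρ , N≡ , t₀≤t , ρ<D) =
    r + 10 * t , P + ρ , n≡ , ≤-trans (*-monoʳ-≤ 10 t₀≤t) (m≤n+m _ r) , s<10k , m≤m+n P ρ , +-monoʳ-≤ P (s≤s⁻¹ ρ<D)
    where
    n≡ : n ≡ enclose ℓ (r + 10 * t) (P + ρ)
    n≡ = trans (m≡m%n+[m/n]*n n 10) (trans (cong (λ N → r + N * 10) N≡) (assemble r t ρ P))
    t<k : t < k
    t<k = *-cancelʳ-< D t k (≤-<-trans (subst (t * D ≤_) (sym N≡) (≤-trans (m≤n+m (t * D) _) (m≤m+n _ ρ)))
                                        (m<n*o⇒m/o<n upper))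
    s<10k : r + 10 * t < 10 * k
    s<10k = <-≤-trans (+-monoˡ-< (10 * t) (m%n<n n 10)) (subst (_≤ 10 * k) (*-suc 10 t) (*-monoʳ-≤ 10 t<k))

sumOf15-pal : ∀ ℓ {m} → 10 ^ suc ℓ ≤ m → m ≤ 11 * 10 ^ suc ℓ → Admissible (suc ℓ) m → SumOf 15 (Pal (suc ℓ)) m
sumOf15-pal zero       _ m≤110  _                = sumOf-map single (sumOf-digits 15 (≤-trans m≤110 (m≤m+n 110 25)))
sumOf15-pal (suc zero) _ m≤1100 (divides q refl) =
  subst (SumOf 15 (Pal 2)) (eleven q) (sumOf-enclose 0 (λ d<10 p → wrap d<10 p) (sumOf-digits 15 q≤135) (sumOf-zero {Pal 0} 15 empty))
  where
  q≤135 : q ≤ 135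
  q≤135 = *-cancelʳ-≤ q 135 11 (≤-trans m≤1100 (m≤m+n 1100 385))
  eleven : ∀ q → q + 10 * (0 + 1 * q) ≡ q * 11
  eleven = solve-∀
sumOf15-pal (suc (suc ℓ)) {n} lower upper adm = from-decomposition (enclose-decomposition (suc ℓ) 0 11 n lower′ upper′)
  where
  P : ℕ
  P = 10 ^ suc (suc ℓ)
  lower′ : (P + 0) * 10 ≤ n
  lower′ = subst (_≤ n) (trans (*-comm 10 P) (cong (_* 10) (sym (+-identityʳ P)))) lower
  bound : ∀ p → 11 * (10 * p) + 110 ≡ 11 * (1 + p) * 10
  bound = solve-∀
  upper′ : n < 11 * outerUnit (suc ℓ) * 10
  upper′ = subst (n <_) (bound P) (≤-<-trans upper (m<m+n (11 * (10 * P)) (s≤s z≤n)))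
  from-decomposition : (∃₂ λ s m → n ≡ enclose (suc ℓ) s m × 0 ≤ s × s < 110 × 10 ^ suc ℓ ≤ m × m ≤ 11 * 10 ^ suc ℓ) →
                       SumOf 15 (Pal (3 + ℓ)) n
  from-decomposition (s , m , n≡ , _ , s<110 , m≥ , m≤) = subst (SumOf 15 (Pal (3 + ℓ))) (sym n≡)
    (sumOf-enclose (suc ℓ) (λ d<10 p → wrap d<10 p) (sumOf-digits 15 (≤-trans (<⇒≤ s<110) (m≤m+n 110 25)))
                   (sumOf15-pal ℓ m≥ m≤ (admissible-enclose⁻ (suc ℓ) s (subst (Admissible (suc ℓ)) n≡ adm))))

sumOf-enclose-zero : ∀ ℓ k {s} → s ≤ 9 * k → SumOf k IsPalindrome (enclose ℓ s 0)
sumOf-enclose-zero ℓ k s≤ =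
  sumOf-enclose ℓ (λ { d<10 refl → enclose-zero-isPalindrome ℓ d<10 }) (sumOf-digits k s≤) (sumOf-zero {_≡ 0} k refl)

split-outer : ∀ {s} → 15 ≤ s → s ≤ 423 → ∃₂ λ a b → s ≡ a + b × 15 ≤ a × a ≤ 135 × b ≤ 288
split-outer {s} 15≤s s≤423 =
  135 ⊓ s , s ∸ 135 , sym (m⊓n+n∸m≡n 135 s) , ⊓-glb (m≤m+n 15 120) 15≤s , m⊓n≤m 135 s , m≤n+o⇒m∸n≤o s 135 s≤423

sumOf47-palindromes : ∀ ℓ {n} → 11 ∣ n → 3 * 10 ^ (3 + ℓ) + 20 ≤ n → n < 42 * 10 ^ (3 + ℓ) → SumOf 47 IsPalindrome n
sumOf47-palindromes ℓ {n} 11∣n lower upper = from-decomposition (enclose-decomposition (suc ℓ) 2 42 n lower′ upper′)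
  where
  P : ℕ
  P = 10 ^ suc (suc ℓ)
  thirty : ∀ p → 3 * (10 * p) + 20 ≡ (p + 2 * (1 + p)) * 10
  thirty = solve-∀
  lower′ : (P + 2 * outerUnit (suc ℓ)) * 10 ≤ n
  lower′ = subst (_≤ n) (thirty P) lower
  fortytwo : ∀ p → 42 * (10 * p) + 420 ≡ 42 * (1 + p) * 10
  fortytwo = solve-∀
  upper′ : n < 42 * outerUnit (suc ℓ) * 10
  upper′ = subst (n <_) (fortytwo P) (<-≤-trans upper (m≤m+n (42 * (10 * P)) 420))
  from-decomposition : (∃₂ λ s m → n ≡ enclose (suc ℓ) s m × 20 ≤ s × s < 420 × 10 ^ suc ℓ ≤ m × m ≤ 11 * 10 ^ suc ℓ) →
                       SumOf 47 IsPalindrome n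
  from-decomposition (s , m , n≡ , 20≤s , s<420 , m≥ , m≤) = from-split (split-outer (≤-trans (m≤m+n 15 5) 20≤s) (≤-trans (<⇒≤ s<420) (m≤m+n 420 3)))
    where
    adm : Admissible (suc ℓ) m
    adm = admissible-enclose⁻ (suc ℓ) s (admissible (suc ℓ) (subst (11 ∣_) n≡ 11∣n))
    from-split : (∃₂ λ a b → s ≡ a + b × 15 ≤ a × a ≤ 135 × b ≤ 288) → SumOf 47 IsPalindrome n
    from-split (a , b , s≡ , 15≤a , a≤135 , b≤288) = subst (SumOf 47 IsPalindrome) n≡′
      (sumOf-++ (sumOf-enclose (suc ℓ) (λ (0<d , d<10) → enclose-isPalindrome 0<d d<10) (sumOf-nonzeroDigits 15 15≤a a≤135) (sumOf15-pal ℓ m≥ m≤ adm))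
                (sumOf-enclose-zero (suc ℓ) 32 b≤288))
      where
      n≡′ : enclose (suc ℓ) a m + enclose (suc ℓ) b 0 ≡ n
      n≡′ = sym (trans n≡ (trans (cong₂ (enclose (suc ℓ)) s≡ (sym (+-identityʳ m))) (enclose-+ (suc ℓ) a b m 0)))

sumOf-digitPalindromes : ∀ k {s} → s ≤ 9 * k → SumOf k IsPalindrome s
sumOf-digitPalindromes k s≤ = sumOf-map digit-isPalindrome (sumOf-digits k s≤)

sumOf49-small : ∀ {n} → n < 3030 → SumOf 49 IsPalindrome n
sumOf49-small {n} n<3030 = subst (SumOf 49 IsPalindrome) n≡
  (sumOf-++ (sumOf-enclose-zero 1 4 q≤36)
  (sumOf-++ (sumOf-enclose-zero 0 1 b≤9)
  (sumOf-++ (sumOf-digitPalindromes 2 c≤18) (sumOf-zero 42 (digit-isPalindrome (s≤s z≤n))))))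
  where
  q b c : ℕ
  q = n / 101
  b = (n % 101) / 11
  c = (n % 101) % 11
  q≤36 : q ≤ 36
  q≤36 = ≤-trans (<⇒≤ (m<n*o⇒m/o<n {n} {30} {101} n<3030)) (m≤m+n 30 6)
  b≤9 : b ≤ 9
  b≤9 = s≤s⁻¹ (m<n*o⇒m/o<n {n % 101} {10} {11} (≤-trans (m%n<n n 101) (m≤m+n 101 9)))
  c≤18 : c ≤ 18
  c≤18 = ≤-trans (s≤s⁻¹ (m%n<n (n % 101) 11)) (m≤m+n 10 8)
  regroup : ∀ q b c → q + 10 * (0 + 10 * q) + (b + 10 * (0 + 1 * b) + (c + 0)) ≡ c + b * 11 + q * 101
  regroup = solve-∀
  n≡ : enclose 1 q 0 + (enclose 0 b 0 + (c + 0)) ≡ n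
  n≡ = begin
    enclose 1 q 0 + (enclose 0 b 0 + (c + 0)) ≡⟨ regroup q b c ⟩
    c + b * 11 + q * 101                       ≡⟨ cong (_+ q * 101) (m≡m%n+[m/n]*n (n % 101) 11) ⟨
    n % 101 + q * 101                          ≡⟨ m≡m%n+[m/n]*n n 101 ⟨
    n                                          ∎
    where open ≡-Reasoning

n<10^n : ∀ n → n < 10 ^ n
n<10^n zero    = s≤s z≤n
n<10^n (suc n) = ≤-<-trans (n<10^n n) (^-monoʳ-< 10 (s≤s (s≤s z≤n)) (n<1+n n))

-- The ranges [3 · 10 ^ (3 + ℓ) + 30, 42 · 10 ^ (3 + ℓ)) overlap and cover everything from 3030 on.
magnitude : ∀ {n} → 3030 ≤ n → ∃[ ℓ ] (3 * 10 ^ (3 + ℓ) + 30 ≤ n × n < 42 * 10 ^ (3 + ℓ))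
magnitude {n} 3030≤n = below n (m≤n⇒m≤o*n 42 (≤-trans (n<10^n n) (^-monoʳ-≤ 10 (m≤n+m n 3))))
  where
  ranges-overlap : ∀ k → 3 * 10 ^ (4 + k) + 30 ≤ 42 * 10 ^ (3 + k)
  ranges-overlap k = subst₂ _≤_ (sym (expand (10 ^ k))) (expand′ (10 ^ k))
                            (+-monoʳ-≤ _ (≤-trans (m≤m+n 30 11970) (*-monoʳ-≤ 12000 (m^n>0 10 k))))
    where
    expand : ∀ y → 3 * (10 * (10 * (10 * (10 * y)))) + 30 ≡ 30000 * y + 30
    expand = solve-∀
    expand′ : ∀ y → 30000 * y + 12000 * y ≡ 42 * (10 * (10 * (10 * y)))
    expand′ = solve-∀
  below : ∀ k → n < 42 * 10 ^ (3 + k) → ∃[ ℓ ] (3 * 10 ^ (3 + ℓ) + 30 ≤ n × n < 42 * 10 ^ (3 + ℓ))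
  below zero    upper = 0 , 3030≤n , upper
  below (suc k) upper = try (3 * 10 ^ (4 + k) + 30 ≤? n)
    where
    try : Dec (3 * 10 ^ (4 + k) + 30 ≤ n) → ∃[ ℓ ] (3 * 10 ^ (3 + ℓ) + 30 ≤ n × n < 42 * 10 ^ (3 + ℓ))
    try (yes lower) = suc k , lower , upper
    try (no  n<)    = below k (<-≤-trans (≰⇒> n<) (ranges-overlap k))

sumOf49-large : ∀ {n} → 3030 ≤ n → SumOf 49 IsPalindrome n
sumOf49-large {n} 3030≤n = from-magnitude (magnitude 3030≤n)
  where
  q c : ℕ
  q = n / 11
  c = n % 11
  n≡ : n ≡ c + q * 11
  n≡ = m≡m%n+[m/n]*n n 11
  from-magnitude : ∃[ ℓ ] (3 * 10 ^ (3 + ℓ) + 30 ≤ n × n < 42 * 10 ^ (3 + ℓ)) → SumOf 49 IsPalindrome n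
  from-magnitude (ℓ , lower , upper) = subst (SumOf 49 IsPalindrome) (trans (+-comm (q * 11) c) (sym n≡))
    (sumOf-++ (sumOf47-palindromes ℓ (n∣m*n q) lower′ (≤-<-trans (m/n*n≤m n 11) upper))
              (sumOf-digitPalindromes 2 (≤-trans (s≤s⁻¹ (m%n<n n 11)) (m≤m+n 10 8))))
    where
    X : ℕ
    X = 3 * 10 ^ (3 + ℓ)
    shift : ∀ x → 10 + (x + 20) ≡ x + 30
    shift = solve-∀
    lower′ : X + 20 ≤ q * 11
    lower′ = +-cancelˡ-≤ 10 (X + 20) (q * 11) (begin
      10 + (X + 20) ≡⟨ shift X ⟩
      X + 30        ≤⟨ lower ⟩
      n             ≡⟨ n≡ ⟩
      c + q * 11    ≤⟨ +-monoˡ-≤ (q * 11) (s≤s⁻¹ (m%n<n n 11)) ⟩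
      10 + q * 11   ∎)
      where open ≤-Reasoning

theorem1p1 : (n : ℕ) → Σ (Vec ℕ 49) λ ps → All IsPalindrome ps × vsum ps ≡ n
theorem1p1 n with n <? 3030
... | yes n<3030 = sumOf49-small n<3030
... | no  n≮3030 = sumOf49-large (≮⇒≥ n≮3030)
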